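{- Let $M\in\mathbb{R}^{r\times n}$ (where $0<r\le n$) be a full-rank weakly unimodular matrix and assume that the first $r$ columns of $M$ are linearly independent. Then for any $a_1,\dots,a_r\in\mathbb{Z}$ there exist unique $a_{r+1},\dots,a_n\in\mathbb{Z}$ such that $(a_1,\dots,a_n)\in\Gamma(M)$. In other words, there exists a unique cut $\boldsymbol{\gamma}\in\Gamma(M)$ having $a_1,\dots,a_r$ as its first $r$ entries.
   Context: A matrix $M\in\mathbb{R}^{r\times n}$ with $0<r\le n$ is full-rank weakly unimodular if it has rank $r$ and every $r\times r$ minor lies in $\{0,\pm1\}$. The lattice of integer cuts of $M$ is $\Gamma(M)=\mathrm{row}(M)\cap\mathbb{Z}^n$, where $\mathrm{row}(M)\subseteq\mathbb{R}^n$ is the row space. -}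

module Defs where

-- Linear algebra over an abstract field of characteristic zero
-- (stand-in for ℝ, which agda-stdlib does not provide).

open import Level using (Level; _⊔_)
open import Algebra.Bundles using (CommutativeRing)
open import Data.Nat as ℕ using (ℕ; zero; suc)
open import Data.Integer as ℤ using (ℤ; +_; -[1+_])
open import Data.Fin as Fin using (Fin; zero; suc; punchIn; inject≤)
open import Data.Product using (Σ; ∃; _×_; _,_)
open import Data.Sum using (_⊎_)
open import Relation.Nullary using (¬_)
open import Relation.Binary.PropositionalEquality using (_≡_)

module LinAlg {c ℓ : Level} (R : CommutativeRing c ℓ) where
  open CommutativeRing R using (Carrier; _≈_; _+_; _*_; -_; 0#; 1#)

  sumF : {m : ℕ} → (Fin m → Carrier) → Carrier
  sumF {zero}  f = 0#
  sumF {suc m} f = f zero + sumF (λ i → f (suc i))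

  sgn : {m : ℕ} → Fin m → Carrier
  sgn zero    = 1#
  sgn (suc j) = - sgn j

  det : {m : ℕ} → (Fin m → Fin m → Carrier) → Carrier
  det {zero}  A = 1#
  det {suc m} A =
    sumF (λ j → sgn j * (A zero j * det (λ i k → A (suc i) (punchIn j k))))

  fromℕ : ℕ → Carrier
  fromℕ zero    = 0#
  fromℕ (suc n) = 1# + fromℕ n

  fromℤ : ℤ → Carrier
  fromℤ (+ n)      = fromℕ n
  fromℤ -[1+ n ]   = - fromℕ (suc n)

  IsField : Set (c ⊔ ℓ)
  IsField = (¬ (1# ≈ 0#)) × (∀ x → ¬ (x ≈ 0#) → ∃ λ y → x * y ≈ 1#)

  CharZero : Set ℓ
  CharZero = ∀ a b → fromℤ a ≈ fromℤ b → a ≡ b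

  LinIndep : {k m : ℕ} → (Fin k → Fin m → Carrier) → Set (c ⊔ ℓ)
  LinIndep {k} {m} v =
    (coef : Fin k → Carrier) →
    (∀ t → sumF (λ i → coef i * v i t) ≈ 0#) → ∀ i → coef i ≈ 0#

  HasFullRowRank : {r n : ℕ} → (Fin r → Fin n → Carrier) → Set (c ⊔ ℓ)
  HasFullRowRank M = LinIndep M

  -- strictly increasing column selection (an r-subset of the columns)
  StrictlyIncreasing : {r n : ℕ} → (Fin r → Fin n) → Set
  StrictlyIncreasing σ = ∀ i j → i Fin.< j → σ i Fin.< σ j

  InZeroPmOne : Carrier → Set ℓ
  InZeroPmOne x = (x ≈ 0#) ⊎ (x ≈ 1#) ⊎ (x ≈ - 1#)

  FullRankWeaklyUnimodular : {r n : ℕ} → (Fin r → Fin n → Carrier) → Set (c ⊔ ℓ)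
  FullRankWeaklyUnimodular {r} {n} M =
    HasFullRowRank M ×
    ((σ : Fin r → Fin n) → StrictlyIncreasing σ →
       InZeroPmOne (det (λ i k → M i (σ k))))

  InRowSpace : {r n : ℕ} → (Fin r → Fin n → Carrier) → (Fin n → Carrier) → Set (c ⊔ ℓ)
  InRowSpace {r} M x = ∃ λ (y : Fin r → Carrier) → ∀ j → x j ≈ sumF (λ i → y i * M i j)

  -- γ ∈ Γ(M) = row(M) ∩ ℤⁿ
  IntegerCut : {r n : ℕ} → (Fin r → Fin n → Carrier) → (Fin n → ℤ) → Set (c ⊔ ℓ)
  IntegerCut M γ = InRowSpace M (λ j → fromℤ (γ j))

  FirstColumnsIndep : {r n : ℕ} → .(r ℕ.≤ n) → (Fin r → Fin n → Carrier) → Set (c ⊔ ℓ)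
  FirstColumnsIndep r≤n M = LinIndep (λ k i → M i (inject≤ k r≤n))

-- Let B be the square matrix of the first r columns of M. Its columns are independent, so
-- det B ≠ 0 (Gaussian elimination), and as a maximal minor det B = ±1. Cramer's rule then
-- produces a vector of the row space with any prescribed first r entries. Conversely, if x
-- lies in the row space, then for every column j the matrix formed by the columns 1, …, r, j
-- of M, bordered by the corresponding entries of x as an extra row, is singular; expanding
-- it along that row expresses x_j through x_1, …, x_r, det B and maximal minors of M. This
-- determines x_j, and for j > r the chosen columns are increasing, so the minors lie in
-- {0, ±1} and x_j is an integer whenever x_1, …, x_r are.

module Submission where

open import Defs
open import Level using (Level; _⊔_)
open import Algebra.Bundles using (CommutativeRing)
import Algebra.Solver.Ring
open import Algebra.Solver.Ring.AlmostCommutativeRing as ACR using (_-Raw-AlmostCommutative⟶_)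
open import Data.Empty using (⊥; ⊥-elim)
open import Data.Fin as Fin using (Fin; zero; suc; punchIn; inject≤)
import Data.Fin.Properties as Fin
open import Data.Integer as ℤ using (ℤ; +_; -[1+_])
import Data.Integer.Properties as ℤ
import Data.Maybe as Maybe
open import Data.Nat as ℕ using (ℕ; zero; suc; _≤_; _<_)
import Data.Nat.Properties as ℕ
open import Data.Product using (Σ; ∃; _×_; _,_; proj₁; proj₂)
open import Data.Sum using (inj₁; inj₂)
open import Data.Vec.Functional using (_∷_; tail; removeAt; updateAt; insertAt)
open import Data.Vec.Functional.Properties
  using (updateAt-updates; map-updateAt; insertAt-lookup; insertAt-punchIn)
open import Function using (const)
open import Relation.Binary.PropositionalEquality as ≡ using (_≡_)
open import Relation.Nullary using (¬_; yes; no)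
open import Relation.Nullary.Decidable using (dec⇒maybe)

module _ {c ℓ : Level} (F : CommutativeRing c ℓ) where

  open CommutativeRing F hiding (zero)
  open LinAlg F
  open import Relation.Binary.Reasoning.Setoid setoid
  open import Algebra.Properties.Ring ring using (-‿involutive; -0#≈0#; -‿distribˡ-*; -‿distribʳ-*; -1*x≈-x)
  open import Algebra.Properties.AbelianGroup +-abelianGroup using (⁻¹-∙-comm; x∙y⁻¹≈ε⇒x≈y; inverseˡ-unique)
  open import Algebra.Properties.CommutativeSemigroup +-commutativeSemigroup using (interchange)
  open import Algebra.Properties.Semiring.Mult semiring using (×-homo-+) renaming (_×_ to _·_)
  open import Algebra.Properties.Semiring.Sum semiring
    using (sum; sum-cong-≋; sum-cong-≗; ∑-distrib-+; ∑-comm; sum-remove; *-distribˡ-sum; sum-replicate-zero)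

  -- The image of ℤ

  fromℕ≈×1# : ∀ n → fromℕ n ≈ n · 1#
  fromℕ≈×1# zero    = refl
  fromℕ≈×1# (suc n) = +-congˡ (fromℕ≈×1# n)

  fromℕ-+ : ∀ m n → fromℕ (m ℕ.+ n) ≈ fromℕ m + fromℕ n
  fromℕ-+ m n = begin
    fromℕ (m ℕ.+ n)       ≈⟨ fromℕ≈×1# (m ℕ.+ n) ⟩
    (m ℕ.+ n) · 1#        ≈⟨ ×-homo-+ 1# m n ⟩
    m · 1# + n · 1#       ≈⟨ +-cong (fromℕ≈×1# m) (fromℕ≈×1# n) ⟨
    fromℕ m + fromℕ n     ∎

  fromℤ-⊖ : ∀ m n → fromℤ (m ℤ.⊖ n) ≈ fromℕ m - fromℕ n
  fromℤ-⊖ m       zero    = sym (trans (+-congˡ -0#≈0#) (+-identityʳ _))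
  fromℤ-⊖ zero    (suc n) = sym (+-identityˡ _)
  fromℤ-⊖ (suc m) (suc n) = begin
    fromℤ (suc m ℤ.⊖ suc n)                ≡⟨ ≡.cong fromℤ (ℤ.[1+m]⊖[1+n]≡m⊖n m n) ⟩
    fromℤ (m ℤ.⊖ n)                        ≈⟨ fromℤ-⊖ m n ⟩
    fromℕ m - fromℕ n                      ≈⟨ +-identityˡ _ ⟨
    0# + (fromℕ m - fromℕ n)               ≈⟨ +-congʳ (-‿inverseʳ 1#) ⟨
    (1# - 1#) + (fromℕ m - fromℕ n)        ≈⟨ interchange 1# (- 1#) (fromℕ m) (- fromℕ n) ⟩
    (1# + fromℕ m) + (- 1# - fromℕ n)      ≈⟨ +-congˡ (⁻¹-∙-comm 1# (fromℕ n)) ⟩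
    (1# + fromℕ m) - (1# + fromℕ n)        ∎

  fromℤ-+ : ∀ i j → fromℤ (i ℤ.+ j) ≈ fromℤ i + fromℤ j
  fromℤ-+ -[1+ m ] -[1+ n ] = begin
    - fromℕ (suc (suc (m ℕ.+ n)))          ≡⟨ ≡.cong (λ k → - fromℕ (suc k)) (ℕ.+-suc m n) ⟨
    - fromℕ (suc m ℕ.+ suc n)              ≈⟨ -‿cong (fromℕ-+ (suc m) (suc n)) ⟩
    - (fromℕ (suc m) + fromℕ (suc n))      ≈⟨ ⁻¹-∙-comm _ _ ⟨
    - fromℕ (suc m) - fromℕ (suc n)        ∎
  fromℤ-+ -[1+ m ] (+ n)    = trans (fromℤ-⊖ n (suc m)) (+-comm _ _)
  fromℤ-+ (+ m)    -[1+ n ] = fromℤ-⊖ m (suc n)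
  fromℤ-+ (+ m)    (+ n)    = fromℕ-+ m n

  fromℤ-neg : ∀ i → fromℤ (ℤ.- i) ≈ - fromℤ i
  fromℤ-neg -[1+ n ]  = sym (-‿involutive _)
  fromℤ-neg (+ zero)  = sym -0#≈0#
  fromℤ-neg (+ suc n) = refl

  fromℤ-*-+ : ∀ i n → fromℤ (i ℤ.* + n) ≈ fromℤ i * fromℕ n
  fromℤ-*-+ i zero    = begin
    fromℤ (i ℤ.* + 0)                ≡⟨ ≡.cong fromℤ (ℤ.*-zeroʳ i) ⟩
    0#                               ≈⟨ zeroʳ (fromℤ i) ⟨
    fromℤ i * 0#                     ∎
  fromℤ-*-+ i (suc n) = begin
    fromℤ (i ℤ.* + suc n)            ≡⟨ ≡.cong fromℤ (ℤ.*-suc i (+ n)) ⟩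
    fromℤ (i ℤ.+ i ℤ.* + n)          ≈⟨ fromℤ-+ i (i ℤ.* + n) ⟩
    fromℤ i + fromℤ (i ℤ.* + n)      ≈⟨ +-cong (sym (*-identityʳ _)) (fromℤ-*-+ i n) ⟩
    fromℤ i * 1# + fromℤ i * fromℕ n ≈⟨ distribˡ (fromℤ i) 1# (fromℕ n) ⟨
    fromℤ i * (1# + fromℕ n)         ∎

  fromℤ-* : ∀ i j → fromℤ (i ℤ.* j) ≈ fromℤ i * fromℤ j
  fromℤ-* i (+ n)    = fromℤ-*-+ i n
  fromℤ-* i -[1+ n ] = begin
    fromℤ (i ℤ.* -[1+ n ])           ≡⟨ ≡.cong fromℤ (ℤ.neg-distribʳ-* i (+ suc n)) ⟨
    fromℤ (ℤ.- (i ℤ.* + suc n))      ≈⟨ fromℤ-neg (i ℤ.* + suc n) ⟩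
    - fromℤ (i ℤ.* + suc n)          ≈⟨ -‿cong (fromℤ-*-+ i (suc n)) ⟩
    - (fromℤ i * fromℕ (suc n))      ≈⟨ -‿distribʳ-* (fromℤ i) (fromℕ (suc n)) ⟩
    fromℤ i * - fromℕ (suc n)        ∎

  -- The solver compares numerals up to definitional equality, so its interpretation of
  -- ℤ must send 1 to 1# itself rather than to fromℤ (+ 1) = 1# + 0#.
  ⟦_⟧ℕ : ℕ → Carrier
  ⟦ zero ⟧ℕ        = 0#
  ⟦ suc zero ⟧ℕ    = 1#
  ⟦ suc (suc n) ⟧ℕ = 1# + ⟦ suc n ⟧ℕ

  ⟦_⟧ℤ : ℤ → Carrier
  ⟦ + n ⟧ℤ      = ⟦ n ⟧ℕ
  ⟦ -[1+ n ] ⟧ℤ = - ⟦ suc n ⟧ℕ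

  ⟦⟧ℕ≈fromℕ : ∀ n → ⟦ n ⟧ℕ ≈ fromℕ n
  ⟦⟧ℕ≈fromℕ zero          = refl
  ⟦⟧ℕ≈fromℕ (suc zero)    = sym (+-identityʳ 1#)
  ⟦⟧ℕ≈fromℕ (suc (suc n)) = +-congˡ (⟦⟧ℕ≈fromℕ (suc n))

  ⟦⟧ℤ≈fromℤ : ∀ i → ⟦ i ⟧ℤ ≈ fromℤ i
  ⟦⟧ℤ≈fromℤ (+ n)      = ⟦⟧ℕ≈fromℕ n
  ⟦⟧ℤ≈fromℤ -[1+ n ]   = -‿cong (⟦⟧ℕ≈fromℕ (suc n))

  ℤ-homomorphism : ℤ.+-*-rawRing -Raw-AlmostCommutative⟶ ACR.fromCommutativeRing F
  ℤ-homomorphism = record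
    { ⟦_⟧    = ⟦_⟧ℤ
    ; +-homo = λ i j → trans (⟦⟧ℤ≈fromℤ (i ℤ.+ j))
                         (trans (fromℤ-+ i j) (sym (+-cong (⟦⟧ℤ≈fromℤ i) (⟦⟧ℤ≈fromℤ j))))
    ; *-homo = λ i j → trans (⟦⟧ℤ≈fromℤ (i ℤ.* j))
                         (trans (fromℤ-* i j) (sym (*-cong (⟦⟧ℤ≈fromℤ i) (⟦⟧ℤ≈fromℤ j))))
    ; -‿homo = λ i → trans (⟦⟧ℤ≈fromℤ (ℤ.- i)) (trans (fromℤ-neg i) (sym (-‿cong (⟦⟧ℤ≈fromℤ i))))
    ; 0-homo = refl
    ; 1-homo = refl
    }

  open Algebra.Solver.Ring ℤ.+-*-rawRing (ACR.fromCommutativeRing F) ℤ-homomorphism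
         (λ i j → Maybe.map (λ i≡j → reflexive (≡.cong ⟦_⟧ℤ i≡j)) (dec⇒maybe (i ℤ.≟ j)))
    using (solve; _:=_; _:+_; _:*_; :-_; con)

  sumF≡sum : ∀ {m} (f : Fin m → Carrier) → sumF f ≡ sum f
  sumF≡sum {zero}  f = ≡.refl
  sumF≡sum {suc m} f = ≡.cong (λ s → f zero + s) (sumF≡sum (λ i → f (suc i)))

  sumF-cong : ∀ {m} {f g : Fin m → Carrier} → (∀ i → f i ≈ g i) → sumF f ≈ sumF g
  sumF-cong {f = f} {g} f≈g rewrite sumF≡sum f | sumF≡sum g = sum-cong-≋ f≈g

  sumF-zero : ∀ {m} {f : Fin m → Carrier} → (∀ i → f i ≈ 0#) → sumF f ≈ 0#
  sumF-zero {m} f≈0 = trans (sumF-cong f≈0) (trans (reflexive (sumF≡sum {m} (λ _ → 0#))) (sum-replicate-zero m))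

  sumF-+ : ∀ {m} (f g : Fin m → Carrier) → sumF (λ i → f i + g i) ≈ sumF f + sumF g
  sumF-+ f g rewrite sumF≡sum f | sumF≡sum g | sumF≡sum (λ i → f i + g i) = ∑-distrib-+ f g

  *-distribˡ-sumF : ∀ {m} x (f : Fin m → Carrier) → x * sumF f ≈ sumF (λ i → x * f i)
  *-distribˡ-sumF x f rewrite sumF≡sum f | sumF≡sum (λ i → x * f i) = *-distribˡ-sum x f

  sumF-comm : ∀ {m k} (f : Fin m → Fin k → Carrier) →
              sumF (λ i → sumF (f i)) ≈ sumF (λ j → sumF (λ i → f i j))
  sumF-comm {m} {k} f = begin
    sumF (λ i → sumF (f i))                 ≡⟨ ≡.trans (sumF≡sum {m} _) (sum-cong-≗ (λ i → sumF≡sum (f i))) ⟩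
    sum (λ i → sum (f i))                   ≈⟨ ∑-comm f ⟩
    sum (λ j → sum (λ i → f i j))           ≡⟨ ≡.trans (sumF≡sum {k} _) (sum-cong-≗ (λ j → sumF≡sum (λ i → f i j))) ⟨
    sumF (λ j → sumF (λ i → f i j))         ∎

  sumF-remove : ∀ {m} (i : Fin (suc m)) (f : Fin (suc m) → Carrier) →
                sumF f ≈ f i + sumF (λ a → f (punchIn i a))
  sumF-remove i f rewrite sumF≡sum f | sumF≡sum (λ a → f (punchIn i a)) = sum-remove f

  sumF-neg : ∀ {m} (f : Fin m → Carrier) → - sumF f ≈ sumF (λ i → - f i)
  sumF-neg f = begin
    - sumF f                   ≈⟨ -1*x≈-x (sumF f) ⟨
    - 1# * sumF f              ≈⟨ *-distribˡ-sumF (- 1#) f ⟩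
    sumF (λ i → - 1# * f i)    ≈⟨ sumF-cong (λ i → -1*x≈-x (f i)) ⟩
    sumF (λ i → - f i)         ∎

  -- Determinants

  sgn² : ∀ {m} (i : Fin m) → sgn i * sgn i ≈ 1#
  sgn² zero    = *-identityˡ 1#
  sgn² (suc i) = trans (solve 1 (λ s → (:- s) :* (:- s) := s :* s) refl (sgn i)) (sgn² i)

  Mat : ℕ → Set c
  Mat m = Fin m → Fin m → Carrier

  minor : ∀ {m} → Mat (suc m) → Fin (suc m) → Fin (suc m) → Mat m
  minor A i j a b = A (punchIn i a) (punchIn j b)

  det-cong : ∀ {m} (A B : Mat m) → (∀ i j → A i j ≈ B i j) → det A ≈ det B
  det-cong {zero}  _ _ _   = refl
  det-cong {suc m} A B A≈B = sumF-cong row-term-cong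
    where
    row-term-cong : ∀ j → sgn j * (A zero j * det (minor A zero j)) ≈ sgn j * (B zero j * det (minor B zero j))
    row-term-cong j =
      *-congˡ (*-cong (A≈B zero j) (det-cong (minor A zero j) (minor B zero j) λ a b → A≈B (suc a) (punchIn j b)))

  columnExpansion : ∀ {m} → Mat (suc m) → Carrier
  columnExpansion A = sumF (λ i → sgn i * (A i zero * det (minor A i zero)))

  -- Expanding every first-row minor along its first column yields a double sum whose
  -- terms are those of the column expansion with every minor expanded along its first row.
  det≈columnExpansion : ∀ {m} (A : Mat (suc m)) → det A ≈ columnExpansion A
  det≈columnExpansion {zero}  A = refl
  det≈columnExpansion {suc m} A = +-congˡ (begin
    sumF rowTerm                     ≈⟨ sumF-cong {f = rowTerm} {g = λ j → sumF (λ i → P i j)} expandRowTerm ⟩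
    sumF (λ j → sumF (λ i → P i j))  ≈⟨ sumF-comm (λ j i → P i j) ⟩
    sumF (λ i → sumF (P i))          ≈⟨ sumF-cong {f = λ i → sumF (P i)} {g = columnTerm} collectColumnTerm ⟩
    sumF columnTerm                  ∎)
    where
    D : Fin (suc m) → Fin (suc m) → Mat m
    D i j = minor (minor A zero (suc j)) i zero
    rowTerm columnTerm : Fin (suc m) → Carrier
    rowTerm j    = sgn (suc j) * (A zero (suc j) * det (minor A zero (suc j)))
    columnTerm i = sgn (suc i) * (A (suc i) zero * det (minor A (suc i) zero))
    inner outer P : Fin (suc m) → Fin (suc m) → Carrier
    inner j i = sgn i * (A (suc i) zero * det (D i j))
    outer i j = sgn j * (A zero (suc j) * det (D i j))
    P i j     = sgn (suc j) * (A zero (suc j) * inner j i)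

    expandRowTerm : ∀ j → rowTerm j ≈ sumF (λ i → P i j)
    expandRowTerm j = begin
      rowTerm j
        ≈⟨ *-congˡ (*-congˡ (det≈columnExpansion (minor A zero (suc j)))) ⟩
      sgn (suc j) * (A zero (suc j) * sumF (inner j))
        ≈⟨ *-congˡ (*-distribˡ-sumF (A zero (suc j)) (inner j)) ⟩
      sgn (suc j) * sumF (λ i → A zero (suc j) * inner j i)
        ≈⟨ *-distribˡ-sumF (sgn (suc j)) (λ i → A zero (suc j) * inner j i) ⟩
      sumF (λ i → P i j)
        ∎

    collectColumnTerm : ∀ i → sumF (P i) ≈ columnTerm i
    collectColumnTerm i = begin
      sumF (P i)
        ≈⟨ sumF-cong {f = P i} {g = λ j → sgn (suc i) * (A (suc i) zero * outer i j)} exchange ⟩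
      sumF (λ j → sgn (suc i) * (A (suc i) zero * outer i j))
        ≈⟨ *-distribˡ-sumF (sgn (suc i)) (λ j → A (suc i) zero * outer i j) ⟨
      sgn (suc i) * sumF (λ j → A (suc i) zero * outer i j)
        ≈⟨ *-congˡ (*-distribˡ-sumF (A (suc i) zero) (outer i)) ⟨
      columnTerm i
        ∎
      where
      exchange : ∀ j → P i j ≈ sgn (suc i) * (A (suc i) zero * outer i j)
      exchange j = solve 5 (λ sj a si b d → (:- sj) :* (a :* (si :* (b :* d))) := (:- si) :* (b :* (sj :* (a :* d))))
                           refl (sgn j) (A zero (suc j)) (sgn i) (A (suc i) zero) (det (D i j))

  det-transpose : ∀ {m} (A : Mat m) → det (λ i j → A j i) ≈ det A
  det-transpose {zero}  A = refl
  det-transpose {suc m} A = trans (sumF-cong transposed-term) (sym (det≈columnExpansion A))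
    where
    transposed-term : ∀ j → sgn j * (A j zero * det (λ a b → A (punchIn j b) (suc a)))
                          ≈ sgn j * (A j zero * det (minor A j zero))
    transposed-term j = *-congˡ (*-congˡ (det-transpose (minor A j zero)))

  det-equalRows₀₁ : ∀ {m} (u : Fin (suc (suc m)) → Carrier) R → det (u ∷ u ∷ R) ≈ 0#
  det-equalRows₀₁-minor : ∀ {m} (u : Fin (suc (suc m)) → Carrier) R (i : Fin m) →
                      det (minor (u ∷ u ∷ R) (suc (suc i)) zero) ≈ 0#

  -- Only the first two terms of the column expansion survive, and they cancel.
  det-equalRows₀₁ u R = begin
    det A                                                   ≈⟨ det≈columnExpansion A ⟩
    1# * (u zero * d) + (- 1# * (u zero * d′) + sumF rest)
      ≈⟨ +-congˡ (+-cong (*-congˡ (*-congˡ d′≈d)) (sumF-zero rest≈0)) ⟩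
    1# * (u zero * d) + (- 1# * (u zero * d) + 0#)
      ≈⟨ solve 1 (λ x → con (+ 1) :* x :+ ((:- con (+ 1)) :* x :+ con (+ 0)) := con (+ 0)) refl (u zero * d) ⟩
    0#                                                      ∎
    where
    A  = u ∷ u ∷ R
    d  = det (minor A zero zero)
    d′ = det (minor A (suc zero) zero)
    d′≈d : d′ ≈ d
    d′≈d = det-cong (minor A (suc zero) zero) (minor A zero zero) λ { zero _ → refl ; (suc _) _ → refl }
    rest : _ → Carrier
    rest i = sgn (suc (suc i)) * (R i zero * det (minor A (suc (suc i)) zero))
    rest≈0 : ∀ i → rest i ≈ 0#
    rest≈0 i = trans (*-congˡ (*-congˡ (det-equalRows₀₁-minor u R i))) (trans (*-congˡ (zeroʳ _)) (zeroʳ _))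

  det-equalRows₀₁-minor {suc m} u R i =
    trans (det-cong (minor (u ∷ u ∷ R) (suc (suc i)) zero) (u′ ∷ u′ ∷ R′)
                    λ { zero _ → refl ; (suc zero) _ → refl ; (suc (suc _)) _ → refl })
          (det-equalRows₀₁ u′ R′)
    where
    u′ = λ b → u (suc b)
    R′ = λ a b → R (punchIn i a) (suc b)

  det-swap₀₁ : ∀ {m} (u v : Fin (suc (suc m)) → Carrier) R → det (v ∷ u ∷ R) ≈ - det (u ∷ v ∷ R)
  det-swap₀₁-minor : ∀ {m} (u v : Fin (suc (suc m)) → Carrier) R (i : Fin m) →
                     det (minor (v ∷ u ∷ R) (suc (suc i)) zero)
                       ≈ - det (minor (u ∷ v ∷ R) (suc (suc i)) zero)

  -- The first two terms of the two column expansions are exchanged up to sign; the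
  -- remaining ones are negated by induction.
  det-swap₀₁ u v R = begin
    det A′
      ≈⟨ det≈columnExpansion A′ ⟩
    1# * (v zero * det (minor A′ zero zero)) + (- 1# * (u zero * det (minor A′ (suc zero) zero)) + sumF rest′)
      ≈⟨ +-cong (*-congˡ (*-congˡ (det-cong (minor A′ zero zero) (minor A (suc zero) zero) rows-u)))
                (+-cong (*-congˡ (*-congˡ (det-cong (minor A′ (suc zero) zero) (minor A zero zero) rows-v)))
                        (trans (sumF-cong {f = rest′} negated) (sym (sumF-neg rest)))) ⟩
    1# * (v zero * dv) + (- 1# * (u zero * du) + - sumF rest)
      ≈⟨ solve 5 (λ a b x y s → con (+ 1) :* (b :* y) :+ ((:- con (+ 1)) :* (a :* x) :+ :- s)
                             := :- (con (+ 1) :* (a :* x) :+ ((:- con (+ 1)) :* (b :* y) :+ s)))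
               refl (u zero) (v zero) du dv (sumF rest) ⟩
    - (1# * (u zero * du) + (- 1# * (v zero * dv) + sumF rest))
      ≈⟨ -‿cong (det≈columnExpansion A) ⟨
    - det A
      ∎
    where
    A  = u ∷ v ∷ R
    A′ = v ∷ u ∷ R
    du = det (minor A zero zero)
    dv = det (minor A (suc zero) zero)
    rest rest′ : _ → Carrier
    rest  i = sgn (suc (suc i)) * (R i zero * det (minor A (suc (suc i)) zero))
    rest′ i = sgn (suc (suc i)) * (R i zero * det (minor A′ (suc (suc i)) zero))
    rows-u : ∀ a b → minor A′ zero zero a b ≈ minor A (suc zero) zero a b
    rows-u zero    _ = refl
    rows-u (suc _) _ = refl
    rows-v : ∀ a b → minor A′ (suc zero) zero a b ≈ minor A zero zero a b
    rows-v zero    _ = refl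
    rows-v (suc _) _ = refl
    negated : ∀ i → rest′ i ≈ - rest i
    negated i = trans (*-congˡ (*-congˡ (det-swap₀₁-minor u v R i)))
                      (solve 3 (λ s r d → s :* (r :* (:- d)) := :- (s :* (r :* d))) refl _ _ _)

  det-swap₀₁-minor {suc m} u v R i =
    trans (det-cong (minor (v ∷ u ∷ R) (suc (suc i)) zero) (v′ ∷ u′ ∷ R′) rows)
          (trans (det-swap₀₁ u′ v′ R′)
                 (-‿cong (det-cong (u′ ∷ v′ ∷ R′) (minor (u ∷ v ∷ R) (suc (suc i)) zero)
                                   (λ a b → sym (rows′ a b)))))
    where
    u′ = λ b → u (suc b)
    v′ = λ b → v (suc b)
    R′ = λ a b → R (punchIn i a) (suc b)
    rows : ∀ a b → minor (v ∷ u ∷ R) (suc (suc i)) zero a b ≈ (v′ ∷ u′ ∷ R′) a b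
    rows zero          _ = refl
    rows (suc zero)    _ = refl
    rows (suc (suc _)) _ = refl
    rows′ : ∀ a b → minor (u ∷ v ∷ R) (suc (suc i)) zero a b ≈ (u′ ∷ v′ ∷ R′) a b
    rows′ zero          _ = refl
    rows′ (suc zero)    _ = refl
    rows′ (suc (suc _)) _ = refl

  -- Moving row q + 1 to the front is a swap of the first two rows after moving it to
  -- position 1, which (expanding along the first row) is moving row q to the front in
  -- every first-row minor.
  det-bringToFront : ∀ {m} (A : Mat (suc m)) q → det (A q ∷ removeAt A q) ≈ sgn q * det A
  det-bringToFront A zero = trans (det-cong (A zero ∷ removeAt A zero) A rows) (sym (*-identityˡ (det A)))
    where
    rows : ∀ a b → (A zero ∷ removeAt A zero) a b ≈ A a b
    rows zero    _ = refl
    rows (suc _) _ = refl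
  det-bringToFront {suc m} A (suc q) = begin
    det (A (suc q) ∷ removeAt A (suc q))  ≈⟨ det-cong (A (suc q) ∷ removeAt A (suc q)) (A (suc q) ∷ A zero ∷ Rq) rows ⟩
    det (A (suc q) ∷ A zero ∷ Rq)         ≈⟨ det-swap₀₁ (A zero) (A (suc q)) Rq ⟩
    - det Y                               ≈⟨ -‿cong (sumF-cong {f = λ j → sgn j * (A zero j * det (minor Y zero j))} bring) ⟩
    - sumF (λ j → sgn q * rowTerm j)      ≈⟨ -‿cong (*-distribˡ-sumF (sgn q) rowTerm) ⟨
    - (sgn q * det A)                     ≈⟨ -‿distribˡ-* (sgn q) (det A) ⟩
    - sgn q * det A                       ∎
    where
    Rq = removeAt (λ a → A (suc a)) q
    Y  = A zero ∷ A (suc q) ∷ Rq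
    rowTerm : Fin (suc (suc m)) → Carrier
    rowTerm j = sgn j * (A zero j * det (minor A zero j))
    rows : ∀ a b → (A (suc q) ∷ removeAt A (suc q)) a b ≈ (A (suc q) ∷ A zero ∷ Rq) a b
    rows zero          _ = refl
    rows (suc zero)    _ = refl
    rows (suc (suc _)) _ = refl
    bring : ∀ j → sgn j * (A zero j * det (minor Y zero j)) ≈ sgn q * rowTerm j
    bring j = begin
      sgn j * (A zero j * det (minor Y zero j))
        ≈⟨ *-congˡ (*-congˡ (det-cong (minor Y zero j) (B q ∷ removeAt B q) minor-rows)) ⟩
      sgn j * (A zero j * det (B q ∷ removeAt B q))         ≈⟨ *-congˡ (*-congˡ (det-bringToFront B q)) ⟩
      sgn j * (A zero j * (sgn q * det B))
        ≈⟨ solve 4 (λ s a t d → s :* (a :* (t :* d)) := t :* (s :* (a :* d))) refl (sgn j) (A zero j) (sgn q) (det B) ⟩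
      sgn q * rowTerm j                                     ∎
      where
      B = minor A zero j
      minor-rows : ∀ a b → minor Y zero j a b ≈ (B q ∷ removeAt B q) a b
      minor-rows zero    _ = refl
      minor-rows (suc _) _ = refl

  unit-cancel : ∀ {u v x} → u * v ≈ 1# → u * x ≈ 0# → x ≈ 0#
  unit-cancel {u} {v} {x} uv≈1 ux≈0 = begin
    x              ≈⟨ *-identityˡ x ⟨
    1# * x         ≈⟨ *-congʳ uv≈1 ⟨
    (u * v) * x    ≈⟨ solve 3 (λ u v x → (u :* v) :* x := v :* (u :* x)) refl u v x ⟩
    v * (u * x)    ≈⟨ *-congˡ ux≈0 ⟩
    v * 0#         ≈⟨ zeroʳ v ⟩
    0#             ∎

  det-equalRows : ∀ {m} (A : Mat (suc m)) q → (∀ l → A zero l ≈ A (suc q) l) → det A ≈ 0#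
  det-equalRows {suc m} A q A₀≈A₁₊q = unit-cancel (sgn² (suc q)) (begin
    sgn (suc q) * det A                     ≈⟨ det-bringToFront A (suc q) ⟨
    det (A (suc q) ∷ removeAt A (suc q))    ≈⟨ det-cong _ (A zero ∷ A zero ∷ Rq) rows ⟩
    det (A zero ∷ A zero ∷ Rq)              ≈⟨ det-equalRows₀₁ (A zero) Rq ⟩
    0#                                      ∎)
    where
    Rq = removeAt (λ a → A (suc a)) q
    rows : ∀ a b → (A (suc q) ∷ removeAt A (suc q)) a b ≈ (A zero ∷ A zero ∷ Rq) a b
    rows zero          b = sym (A₀≈A₁₊q b)
    rows (suc zero)    _ = refl
    rows (suc (suc _)) _ = refl

  -- Expand along the first row and the minors by induction; the terms in which w fills
  -- two rows cancel.
  det-rankOneUpdate : ∀ {m} (D : Mat m) (t w : Fin m → Carrier) →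
                      det (λ i l → D i l + t i * w l) ≈ det D + sumF (λ i → t i * det (updateAt D i (const w)))
  det-rankOneUpdate {zero}  D t w = sym (+-identityʳ 1#)
  det-rankOneUpdate {suc m} D t w = begin
    sumF (λ j → sgn j * (E zero j * det (minor E zero j)))
      ≈⟨ sumF-cong {f = λ j → sgn j * (E zero j * det (minor E zero j))} {g = λ j → T₁ j + T₂ j} expandTerm ⟩
    sumF (λ j → T₁ j + T₂ j)
      ≈⟨ trans (sumF-+ T₁ T₂) (+-cong (sumF-+ (P D₀) (λ j → t zero * P w j)) (sumF-+ (Q D₀) (λ j → t zero * Q w j))) ⟩
    (sumF (P D₀) + sumF (λ j → t zero * P w j)) + (sumF (Q D₀) + sumF (λ j → t zero * Q w j))
      ≈⟨ +-cong (+-congˡ (sym (*-distribˡ-sumF (t zero) (P w))))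
                (+-cong (sumQ D₀ (λ a → det-cong (D₀ ∷ tail (U a)) (U a) λ { zero _ → refl ; (suc _) _ → refl }))
                        (trans (sym (*-distribˡ-sumF (t zero) (Q w))) (*-congˡ (sumQ w w-twice)))) ⟩
    (det D + t zero * det U₀) + (sumF (λ a → t (suc a) * det (U a)) + t zero * sumF (λ a → t (suc a) * 0#))
      ≈⟨ +-congˡ (+-congˡ (*-congˡ (sumF-zero (λ a → zeroʳ (t (suc a)))))) ⟩
    (det D + t zero * det U₀) + (sumF (λ a → t (suc a) * det (U a)) + t zero * 0#)
      ≈⟨ solve 4 (λ d x y s → (d :+ x) :+ (y :+ s :* con (+ 0)) := d :+ (x :+ y)) refl _ _ _ (t zero) ⟩
    det D + (t zero * det U₀ + sumF (λ a → t (suc a) * det (U a)))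
      ∎
    where
    D₀ = D zero
    E : Mat (suc m)
    E i l = D i l + t i * w l
    U₀ = updateAt D zero (const w)
    U : Fin m → Mat (suc m)
    U a = updateAt D (suc a) (const w)
    w-twice : ∀ a → det (w ∷ tail (U a)) ≈ 0#
    w-twice a = det-equalRows (w ∷ tail (U a)) a λ l → reflexive (≡.sym (≡.cong-app (updateAt-updates a (tail D)) l))
    S : Fin (suc m) → Carrier
    S j = sumF (λ a → t (suc a) * det (minor (U a) zero j))
    P Q : (Fin (suc m) → Carrier) → Fin (suc m) → Carrier
    P v j = sgn j * (v j * det (minor D zero j))
    Q v j = sgn j * (v j * S j)
    T₁ T₂ : Fin (suc m) → Carrier
    T₁ j = P D₀ j + t zero * P w j
    T₂ j = Q D₀ j + t zero * Q w j

    minor-update : ∀ j a → det (updateAt (minor D zero j) a (const (λ b → w (punchIn j b)))) ≈ det (minor (U a) zero j)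
    minor-update j a = det-cong _ _ λ x b →
      reflexive (≡.cong-app (≡.sym (map-updateAt {f = λ row b → row (punchIn j b)} {g = const w}
                                                 (λ _ → ≡.refl) (tail D) a x)) b)

    expandTerm : ∀ j → sgn j * (E zero j * det (minor E zero j)) ≈ T₁ j + T₂ j
    expandTerm j = begin
      sgn j * ((D₀ j + t zero * w j) * det (minor E zero j))
        ≈⟨ *-congˡ (*-congˡ (trans (det-rankOneUpdate (minor D zero j) (λ a → t (suc a)) (λ b → w (punchIn j b)))
                                    (+-congˡ (sumF-cong (λ a → *-congˡ (minor-update j a)))))) ⟩
      sgn j * ((D₀ j + t zero * w j) * (det (minor D zero j) + S j))
        ≈⟨ solve 6 (λ s x t₀ y d σ → s :* ((x :+ t₀ :* y) :* (d :+ σ))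
                                  := (s :* (x :* d) :+ t₀ :* (s :* (y :* d))) :+ (s :* (x :* σ) :+ t₀ :* (s :* (y :* σ))))
                 refl (sgn j) (D₀ j) (t zero) (w j) (det (minor D zero j)) (S j) ⟩
      T₁ j + T₂ j
        ∎

    sumQ : ∀ v {z : Fin m → Carrier} → (∀ a → det (v ∷ tail (U a)) ≈ z a) → sumF (Q v) ≈ sumF (λ a → t (suc a) * z a)
    sumQ v {z} det≈z = begin
      sumF (Q v)                                    ≈⟨ sumF-cong {f = Q v} {g = λ j → sumF (λ a → R a j)} spread ⟩
      sumF (λ j → sumF (λ a → R a j))               ≈⟨ sumF-comm (λ j a → R a j) ⟩
      sumF (λ a → sumF (R a))                       ≈⟨ sumF-cong (λ a → trans (sym (*-distribˡ-sumF (t (suc a)) (rowTerm a)))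
                                                                              (*-congˡ (det≈z a))) ⟩
      sumF (λ a → t (suc a) * z a)                  ∎
      where
      rowTerm R : Fin m → Fin (suc m) → Carrier
      rowTerm a j = sgn j * (v j * det (minor (U a) zero j))
      R a j       = t (suc a) * rowTerm a j
      spread : ∀ j → Q v j ≈ sumF (λ a → R a j)
      spread j = begin
        sgn j * (v j * S j)
          ≈⟨ *-congˡ (*-distribˡ-sumF (v j) (λ a → t (suc a) * det (minor (U a) zero j))) ⟩
        sgn j * sumF (λ a → v j * (t (suc a) * det (minor (U a) zero j)))
          ≈⟨ *-distribˡ-sumF (sgn j) (λ a → v j * (t (suc a) * det (minor (U a) zero j))) ⟩
        sumF (λ a → sgn j * (v j * (t (suc a) * det (minor (U a) zero j))))
          ≈⟨ sumF-cong (λ a → solve 4 (λ s x τ d → s :* (x :* (τ :* d)) := τ :* (s :* (x :* d)))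
                                      refl (sgn j) (v j) (t (suc a)) (det (minor (U a) zero j))) ⟩
        sumF (λ a → R a j)
          ∎

  -- The bordered matrix H, whose first column repeats column k of C, has determinant 0;
  -- expanding it along that first column gives the identity.
  cramer : ∀ {m} (C : Mat (suc m)) (a : Fin (suc m) → Carrier) k →
           sumF (λ i → (sgn i * det (a ∷ removeAt C i)) * C i k) ≈ a k * det C
  cramer C a k = sym (x∙y⁻¹≈ε⇒x≈y _ _ (begin
    a k * det C - sumF y                             ≈⟨ +-congˡ (sumF-neg y) ⟩
    a k * det C + sumF (λ i → - y i)
      ≈⟨ +-cong (sym (*-identityˡ _)) (sumF-cong {f = λ i → - y i} {g = columnTerm} bordered-term) ⟩
    columnExpansion H                                ≈⟨ det≈columnExpansion H ⟨
    det H                                            ≈⟨ det-transpose H ⟨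
    det Hᵀ                                           ≈⟨ det-equalRows Hᵀ k (λ { zero → refl ; (suc _) → refl }) ⟩
    0#                                               ∎))
    where
    H : Mat (suc (suc _))
    H = (a k ∷ a) ∷ (λ i → C i k ∷ C i)
    Hᵀ : Mat (suc (suc _))
    Hᵀ i j = H j i
    y columnTerm : Fin (suc _) → Carrier
    y i = (sgn i * det (a ∷ removeAt C i)) * C i k
    columnTerm i = sgn (suc i) * (C i k * det (minor H (suc i) zero))
    bordered-term : ∀ i → - y i ≈ columnTerm i
    bordered-term i = begin
      - ((sgn i * det (a ∷ removeAt C i)) * C i k)
        ≈⟨ solve 3 (λ s d x → :- ((s :* d) :* x) := (:- s) :* (x :* d)) refl _ _ _ ⟩
      - sgn i * (C i k * det (a ∷ removeAt C i))
        ≈⟨ *-congˡ (*-congˡ (det-cong (a ∷ removeAt C i) (minor H (suc i) zero) rows)) ⟩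
      columnTerm i
        ∎
      where
      rows : ∀ x b → (a ∷ removeAt C i) x b ≈ minor H (suc i) zero x b
      rows zero    _ = refl
      rows (suc _) _ = refl

  -- Independent columns and nonvanishing determinants

  ColumnsIndependent : ∀ {r m} → (Fin r → Fin m → Carrier) → Set (c ⊔ ℓ)
  ColumnsIndependent A = LinIndep (λ k t → A t k)

  columnsIndependent-rowsCovered : ∀ {r r′ m} (A : Fin r → Fin m → Carrier) (A′ : Fin r′ → Fin m → Carrier) →
                                   (∀ t → ∃ λ t′ → ∀ k → A′ t′ k ≈ A t k) →
                                   ColumnsIndependent A → ColumnsIndependent A′
  columnsIndependent-rowsCovered A A′ covered indep coef coef·A′≈0 = indep coef coef·A≈0
    where
    coef·A≈0 : ∀ t → sumF (λ k → coef k * A t k) ≈ 0#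
    coef·A≈0 t with covered t
    ... | t′ , same = trans (sumF-cong (λ k → *-congˡ (sym (same k)))) (coef·A′≈0 t′)

  columnsIndependent-bringToFront : ∀ {m n} (A : Fin (suc m) → Fin n → Carrier) i →
                                    ColumnsIndependent A → ColumnsIndependent (A i ∷ removeAt A i)
  columnsIndependent-bringToFront A i = columnsIndependent-rowsCovered A (A i ∷ removeAt A i) covered
    where
    covered : ∀ t → ∃ λ t′ → ∀ k → (A i ∷ removeAt A i) t′ k ≈ A t k
    covered t with i Fin.≟ t
    ... | yes ≡.refl = zero , λ _ → refl
    ... | no i≢t     = suc (Fin.punchOut i≢t) , λ k → reflexive (≡.cong (λ s → A s k) (Fin.punchIn-punchOut i≢t))

  addMultiplesOfRow₀ : ∀ {m n} → (Fin (suc m) → Fin n → Carrier) → (Fin m → Carrier) → Fin (suc m) → Fin n → Carrier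
  addMultiplesOfRow₀ A t = A zero ∷ λ a l → A (suc a) l + t a * A zero l

  det-addMultiplesOfRow₀ : ∀ {m} (A : Mat (suc m)) t → det (addMultiplesOfRow₀ A t) ≈ det A
  det-addMultiplesOfRow₀ A t = begin
    det (addMultiplesOfRow₀ A t)
      ≈⟨ det-cong (addMultiplesOfRow₀ A t) (λ i l → A i l + (0# ∷ t) i * A zero l) rows ⟩
    det (λ i l → A i l + (0# ∷ t) i * A zero l)      ≈⟨ det-rankOneUpdate A (0# ∷ t) (A zero) ⟩
    det A + sumF (λ i → (0# ∷ t) i * det (updateAt A i (const (A zero))))  ≈⟨ +-congˡ (sumF-zero vanish) ⟩
    det A + 0#                                       ≈⟨ +-identityʳ (det A) ⟩
    det A                                            ∎
    where
    rows : ∀ i l → addMultiplesOfRow₀ A t i l ≈ A i l + (0# ∷ t) i * A zero l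
    rows zero    l = sym (trans (+-congˡ (zeroˡ _)) (+-identityʳ _))
    rows (suc a) l = refl
    vanish : ∀ i → (0# ∷ t) i * det (updateAt A i (const (A zero))) ≈ 0#
    vanish zero    = zeroˡ _
    vanish (suc a) = trans (*-congˡ (det-equalRows (updateAt A (suc a) (const (A zero))) a
                                       (λ l → reflexive (≡.sym (≡.cong-app (updateAt-updates (suc a) A) l)))))
                           (zeroʳ _)

  columnsIndependent-addMultiplesOfRow₀ : ∀ {m n} (A : Fin (suc m) → Fin n → Carrier) t →
                                          ColumnsIndependent A → ColumnsIndependent (addMultiplesOfRow₀ A t)
  columnsIndependent-addMultiplesOfRow₀ A t indep coef coef·E≈0 = indep coef coef·A≈0
    where
    coef·A≈0 : ∀ row → sumF (λ k → coef k * A row k) ≈ 0#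
    coef·A≈0 zero    = coef·E≈0 zero
    coef·A≈0 (suc a) = begin
      sumF (λ k → coef k * A (suc a) k)
        ≈⟨ +-identityʳ _ ⟨
      sumF (λ k → coef k * A (suc a) k) + 0#
        ≈⟨ +-congˡ (trans (*-congˡ (coef·E≈0 zero)) (zeroʳ (t a))) ⟨
      sumF (λ k → coef k * A (suc a) k) + t a * sumF (λ k → coef k * A zero k)
        ≈⟨ +-congˡ (*-distribˡ-sumF (t a) (λ k → coef k * A zero k)) ⟩
      sumF (λ k → coef k * A (suc a) k) + sumF (λ k → t a * (coef k * A zero k))
        ≈⟨ sumF-+ (λ k → coef k * A (suc a) k) (λ k → t a * (coef k * A zero k)) ⟨
      sumF (λ k → coef k * A (suc a) k + t a * (coef k * A zero k))
        ≈⟨ sumF-cong (λ k → solve 4 (λ c x τ y → c :* x :+ τ :* (c :* y) := c :* (x :+ τ :* y))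
                                    refl (coef k) (A (suc a) k) (t a) (A zero k)) ⟩
      sumF (λ k → coef k * addMultiplesOfRow₀ A t (suc a) k)             ≈⟨ coef·E≈0 (suc a) ⟩
      0#                                                                 ∎

  det-pivot : ∀ {m} (A : Mat (suc m)) → (∀ a → A (suc a) zero ≈ 0#) → det A ≈ A zero zero * det (minor A zero zero)
  det-pivot A column₀≈0 = begin
    det A                                                      ≈⟨ det≈columnExpansion A ⟩
    1# * (A zero zero * det (minor A zero zero)) + sumF below  ≈⟨ +-cong (*-identityˡ _) (sumF-zero {f = below} below≈0) ⟩
    A zero zero * det (minor A zero zero) + 0#                 ≈⟨ +-identityʳ _ ⟩
    A zero zero * det (minor A zero zero)                      ∎
    where
    below : _ → Carrier
    below a = sgn (suc a) * (A (suc a) zero * det (minor A (suc a) zero))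
    below≈0 : ∀ a → below a ≈ 0#
    below≈0 a = trans (*-congˡ (trans (*-congʳ (column₀≈0 a)) (zeroˡ _))) (zeroʳ _)

  columnsIndependent-minor₀₀ : ∀ {m n} (A : Fin (suc m) → Fin (suc n) → Carrier) {p⁻¹} →
                               A zero zero * p⁻¹ ≈ 1# → (∀ a → A (suc a) zero ≈ 0#) →
                               ColumnsIndependent A → ColumnsIndependent (λ a b → A (suc a) (suc b))
  columnsIndependent-minor₀₀ A {p⁻¹} pp⁻¹≈1 column₀≈0 indep c′ c′·minor≈0 b = indep coef coef·A≈0 (suc b)
    where
    S = sumF (λ b → c′ b * A zero (suc b))
    -- the first coefficient is chosen to cancel the first row
    coef : _ → Carrier
    coef = - (p⁻¹ * S) ∷ c′
    coef·A≈0 : ∀ row → sumF (λ k → coef k * A row k) ≈ 0#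
    coef·A≈0 zero    = begin
      - (p⁻¹ * S) * A zero zero + S
        ≈⟨ solve 3 (λ q s p → (:- (q :* s)) :* p :+ s := s :+ (:- ((p :* q) :* s))) refl p⁻¹ S (A zero zero) ⟩
      S - (A zero zero * p⁻¹) * S        ≈⟨ +-congˡ (-‿cong (*-congʳ pp⁻¹≈1)) ⟩
      S - 1# * S                         ≈⟨ solve 1 (λ s → s :+ (:- (con (+ 1) :* s)) := con (+ 0)) refl S ⟩
      0#                                 ∎
    coef·A≈0 (suc a) = begin
      - (p⁻¹ * S) * A (suc a) zero + sumF (λ b → c′ b * A (suc a) (suc b))
        ≈⟨ +-cong (trans (*-congˡ (column₀≈0 a)) (zeroʳ _)) (c′·minor≈0 a) ⟩
      0# + 0#                                                              ≈⟨ +-identityʳ 0# ⟩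
      0#                                                                   ∎

  ¬∀⇒¬¬∃¬ : ∀ {m p} {P : Fin m → Set p} → ¬ (∀ i → P i) → ¬ ¬ (∃ λ i → ¬ P i)
  ¬∀⇒¬¬∃¬ {zero}  ¬∀ _  = ¬∀ λ ()
  ¬∀⇒¬¬∃¬ {suc m} ¬∀ ¬∃ = ¬∃ (zero , λ p₀ → ¬∀⇒¬¬∃¬ (λ pₛ → ¬∀ λ { zero → p₀ ; (suc i) → pₛ i })
                                                    (λ { (i , ¬pᵢ) → ¬∃ (suc i , ¬pᵢ) }))

  -- Gaussian elimination on the first column: bring a nonzero entry to the top, clear the
  -- rest of the column, and recurse on the remaining minor.
  det≉0 : IsField → ∀ {m} (A : Mat m) → ColumnsIndependent A → ¬ det A ≈ 0#
  det≉0 (1≉0 , _)           {zero}  A _              = 1≉0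
  det≉0 fld@(1≉0 , inverse) {suc m} A indep detA≈0 = ¬∀⇒¬¬∃¬ column₀≉0 λ { (i , Aᵢ₀≉0) → eliminate i Aᵢ₀≉0 }
    where
    column₀≉0 : ¬ (∀ i → A i zero ≈ 0#)
    column₀≉0 column₀≈0 = 1≉0 (indep (1# ∷ const 0#) e₀·A≈0 zero)
      where
      e₀·A≈0 : ∀ t → 1# * A t zero + sumF (λ k → 0# * A t (suc k)) ≈ 0#
      e₀·A≈0 t = trans (+-cong (trans (*-identityˡ _) (column₀≈0 t)) (sumF-zero (λ k → zeroˡ (A t (suc k)))))
                       (+-identityʳ 0#)

    eliminate : ∀ i → ¬ A i zero ≈ 0# → ⊥
    eliminate i p≉0 with inverse (A i zero) p≉0
    ... | p⁻¹ , pp⁻¹≈1 = det≉0 fld (minor E zero zero) minor-indep minor≈0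
      where
      A′ = A i ∷ removeAt A i
      E = addMultiplesOfRow₀ A′ (λ a → - (A′ (suc a) zero * p⁻¹))
      E-column₀ : ∀ a → E (suc a) zero ≈ 0#
      E-column₀ a = begin
        x + - (x * p⁻¹) * A i zero
          ≈⟨ solve 3 (λ x q p → x :+ (:- (x :* q)) :* p := x :* (con (+ 1) :+ (:- (p :* q)))) refl x p⁻¹ (A i zero) ⟩
        x * (1# - A i zero * p⁻¹)       ≈⟨ *-congˡ (+-congˡ (-‿cong pp⁻¹≈1)) ⟩
        x * (1# - 1#)                   ≈⟨ *-congˡ (-‿inverseʳ 1#) ⟩
        x * 0#                          ≈⟨ zeroʳ x ⟩
        0#                              ∎
        where x = A′ (suc a) zero
      detE≈0 : det E ≈ 0#
      detE≈0 = begin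
        det E             ≈⟨ det-addMultiplesOfRow₀ A′ _ ⟩
        det A′            ≈⟨ det-bringToFront A i ⟩
        sgn i * det A     ≈⟨ *-congˡ detA≈0 ⟩
        sgn i * 0#        ≈⟨ zeroʳ _ ⟩
        0#                ∎
      minor≈0 : det (minor E zero zero) ≈ 0#
      minor≈0 = unit-cancel pp⁻¹≈1 (trans (sym (det-pivot E E-column₀)) detE≈0)
      minor-indep : ColumnsIndependent (minor E zero zero)
      minor-indep = columnsIndependent-minor₀₀ E pp⁻¹≈1 E-column₀
                      (columnsIndependent-addMultiplesOfRow₀ A′ _ (columnsIndependent-bringToFront A i indep))

  -- The first row is a combination of the other rows, so the expansion along it is a
  -- combination of determinants with two equal rows.
  det-bordered-rowSpace : ∀ {s n} (M : Fin s → Fin n → Carrier) (τ : Fin (suc s) → Fin n) {x} →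
                          InRowSpace M x → det ((λ l → x (τ l)) ∷ λ a l → M a (τ l)) ≈ 0#
  det-bordered-rowSpace {s} M τ {x} (y , x≈yM) = begin
    sumF (λ l → sgn l * (x (τ l) * m l))
      ≈⟨ sumF-cong {f = λ l → sgn l * (x (τ l) * m l)} {g = λ l → sumF (λ i → y i * (sgn l * (M i (τ l) * m l)))} spread ⟩
    sumF (λ l → sumF (λ i → y i * (sgn l * (M i (τ l) * m l))))
      ≈⟨ sumF-comm (λ l i → y i * (sgn l * (M i (τ l) * m l))) ⟩
    sumF (λ i → sumF (λ l → y i * (sgn l * (M i (τ l) * m l))))
      ≈⟨ sumF-zero (λ i → trans (sym (*-distribˡ-sumF (y i) (λ l → sgn l * (M i (τ l) * m l))))
                                (trans (*-congˡ (det-equalRows (K i) i (λ _ → refl))) (zeroʳ (y i)))) ⟩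
    0# ∎
    where
    m : Fin (suc s) → Carrier
    m l = det (λ a b → M a (τ (punchIn l b)))
    K : Fin s → Mat (suc s)
    K i = (λ l → M i (τ l)) ∷ λ a l → M a (τ l)
    spread : ∀ l → sgn l * (x (τ l) * m l) ≈ sumF (λ i → y i * (sgn l * (M i (τ l) * m l)))
    spread l = begin
      sgn l * (x (τ l) * m l)                                ≈⟨ *-congˡ (*-congʳ (x≈yM (τ l))) ⟩
      sgn l * (sumF (λ i → y i * M i (τ l)) * m l)           ≈⟨ *-congˡ (*-comm _ _) ⟩
      sgn l * (m l * sumF (λ i → y i * M i (τ l)))           ≈⟨ *-congˡ (*-distribˡ-sumF (m l) (λ i → y i * M i (τ l))) ⟩
      sgn l * sumF (λ i → m l * (y i * M i (τ l)))           ≈⟨ *-distribˡ-sumF (sgn l) (λ i → m l * (y i * M i (τ l))) ⟩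
      sumF (λ i → sgn l * (m l * (y i * M i (τ l))))
        ≈⟨ sumF-cong (λ i → solve 4 (λ s d y a → s :* (d :* (y :* a)) := y :* (s :* (a :* d)))
                                    refl (sgn l) (m l) (y i) (M i (τ l))) ⟩
      sumF (λ i → y i * (sgn l * (M i (τ l) * m l)))         ∎

  -- Integral elements and increasing column selections

  IsInteger : Carrier → Set ℓ
  IsInteger x = ∃ λ k → x ≈ fromℤ k

  isInteger-resp-≈ : ∀ {x y} → x ≈ y → IsInteger y → IsInteger x
  isInteger-resp-≈ x≈y (k , y≈k) = k , trans x≈y y≈k

  isInteger-+ : ∀ {x y} → IsInteger x → IsInteger y → IsInteger (x + y)
  isInteger-+ (i , x≈i) (j , y≈j) = i ℤ.+ j , trans (+-cong x≈i y≈j) (sym (fromℤ-+ i j))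

  isInteger-* : ∀ {x y} → IsInteger x → IsInteger y → IsInteger (x * y)
  isInteger-* (i , x≈i) (j , y≈j) = i ℤ.* j , trans (*-cong x≈i y≈j) (sym (fromℤ-* i j))

  isInteger-neg : ∀ {x} → IsInteger x → IsInteger (- x)
  isInteger-neg (i , x≈i) = ℤ.- i , trans (-‿cong x≈i) (sym (fromℤ-neg i))

  isInteger-sumF : ∀ {m} {f : Fin m → Carrier} → (∀ i → IsInteger (f i)) → IsInteger (sumF f)
  isInteger-sumF {zero}  _   = + 0 , refl
  isInteger-sumF {suc m} f∈ℤ = isInteger-+ (f∈ℤ zero) (isInteger-sumF (λ i → f∈ℤ (suc i)))

  isInteger-sgn : ∀ {m} (i : Fin m) → IsInteger (sgn i)
  isInteger-sgn zero    = + 1 , sym (+-identityʳ 1#)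
  isInteger-sgn (suc i) = isInteger-neg (isInteger-sgn i)

  isInteger-inZeroPmOne : ∀ {x} → InZeroPmOne x → IsInteger x
  isInteger-inZeroPmOne (inj₁ x≈0)        = + 0 , x≈0
  isInteger-inZeroPmOne (inj₂ (inj₁ x≈1)) = + 1 , trans x≈1 (sym (+-identityʳ 1#))
  isInteger-inZeroPmOne (inj₂ (inj₂ x≈-1)) = -[1+ 0 ] , trans x≈-1 (-‿cong (sym (+-identityʳ 1#)))

  inZeroPmOne-square : ∀ {x} → InZeroPmOne x → ¬ x ≈ 0# → x * x ≈ 1#
  inZeroPmOne-square (inj₁ x≈0)        x≉0 = ⊥-elim (x≉0 x≈0)
  inZeroPmOne-square (inj₂ (inj₁ x≈1)) _   = trans (*-cong x≈1 x≈1) (*-identityˡ 1#)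
  inZeroPmOne-square (inj₂ (inj₂ x≈-1)) _  =
    trans (*-cong x≈-1 x≈-1) (solve 0 ((:- con (+ 1)) :* (:- con (+ 1)) := con (+ 1)) refl)

  punchIn-increasing : ∀ {m} (l : Fin (suc m)) → StrictlyIncreasing (punchIn l)
  punchIn-increasing l i j i<j =
    Fin.≤∧≢⇒< (Fin.punchIn-mono-≤ l i j (ℕ.<⇒≤ i<j)) (λ eq → Fin.<⇒≢ i<j (Fin.punchIn-injective l i j eq))

  ∘-increasing : ∀ {k m n} {f : Fin m → Fin n} {g : Fin k → Fin m} →
                 StrictlyIncreasing f → StrictlyIncreasing g → StrictlyIncreasing (λ i → f (g i))
  ∘-increasing f↑ g↑ i j i<j = f↑ _ _ (g↑ i j i<j)

  inject≤-increasing : ∀ {m n} (m≤n : m ≤ n) → StrictlyIncreasing (λ k → inject≤ k m≤n)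
  inject≤-increasing m≤n i j i<j =
    ≡.subst₂ ℕ._<_ (≡.sym (Fin.toℕ-inject≤ i m≤n)) (≡.sym (Fin.toℕ-inject≤ j m≤n)) i<j

  insertAt-bounded : ∀ {m n} {b : Fin n} (xs : Fin m → Fin n) v →
                     (∀ c → b Fin.< xs c) → b Fin.< v → ∀ i l → b Fin.< insertAt xs i v l
  insertAt-bounded         xs v b<xs b<v zero    zero    = b<v
  insertAt-bounded         xs v b<xs b<v zero    (suc l) = b<xs l
  insertAt-bounded {suc m} xs v b<xs b<v (suc i) zero    = b<xs zero
  insertAt-bounded {suc m} xs v b<xs b<v (suc i) (suc l) = insertAt-bounded (tail xs) v (λ c → b<xs (suc c)) b<v i l

  insertAt-last-increasing : ∀ {m n} (xs : Fin m → Fin n) v → StrictlyIncreasing xs → (∀ c → xs c Fin.< v) →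
                             StrictlyIncreasing (insertAt xs (Fin.fromℕ m) v)
  insertAt-last-increasing {zero}  xs v _   _    zero    zero    ()
  insertAt-last-increasing {suc m} xs v xs↑ xs<v zero    (suc l) _ =
    insertAt-bounded (tail xs) v (λ c → xs↑ zero (suc c) ℕ.z<s) (xs<v zero) (Fin.fromℕ m) l
  insertAt-last-increasing {suc m} xs v xs↑ xs<v (suc l) (suc l′) (ℕ.s<s l<l′) =
    insertAt-last-increasing (tail xs) v (λ i j i<j → xs↑ (suc i) (suc j) (ℕ.s<s i<j)) (λ c → xs<v (suc c)) l l′ l<l′

  -- Integer cuts

  module IntegerCuts (fld : IsField) (charZero : CharZero) {r n : ℕ} (r<n : suc r ≤ n)
                     (M : Fin (suc r) → Fin n → Carrier)
                     (unimodular : FullRankWeaklyUnimodular M) (indep : FirstColumnsIndep r<n M) where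

    ι : Fin (suc r) → Fin n
    ι k = inject≤ k r<n

    B : Mat (suc r)
    B i k = M i (ι k)

    u : Carrier
    u = det B

    u-inZeroPmOne : InZeroPmOne u
    u-inZeroPmOne = proj₂ unimodular ι (inject≤-increasing r<n)

    u² : u * u ≈ 1#
    u² = inZeroPmOne-square u-inZeroPmOne (det≉0 fld B indep)

    last : Fin (suc (suc r))
    last = Fin.fromℕ (suc r)

    τ : Fin n → Fin (suc (suc r)) → Fin n
    τ j = insertAt ι last j

    μ : Fin n → Fin (suc r) → Carrier
    μ j c = det (λ a b → M a (τ j (punchIn (punchIn last c) b)))

    cutFormula : (Fin (suc r) → Carrier) → Fin n → Carrier
    cutFormula p j = - (sgn last * (u * sumF (λ c → sgn (punchIn last c) * (p c * μ j c))))

    -- Expanding the vanishing bordered determinant along its first row and isolating the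
    -- term of column j, whose minor is u.
    rowSpace⇒cutFormula : ∀ {x} → InRowSpace M x → ∀ {p} → (∀ c → x (ι c) ≈ p c) → ∀ j → x j ≈ cutFormula p j
    rowSpace⇒cutFormula {x} x∈row {p} x∘ι≈p j = begin
      x j                                        ≈⟨ *-identityʳ (x j) ⟨
      x j * 1#                                   ≈⟨ *-congˡ (trans (*-cong (sgn² last) u²) (*-identityˡ 1#)) ⟨
      x j * ((sL * sL) * (u * u))
        ≈⟨ solve 3 (λ x s u → x :* ((s :* s) :* (u :* u)) := (s :* u) :* (s :* (x :* u))) refl (x j) sL u ⟩
      (sL * u) * (sL * (x j * u))                ≈⟨ *-congˡ (inverseˡ-unique _ _ bordered≈0) ⟩
      (sL * u) * (- Σp)
        ≈⟨ solve 3 (λ s u σ → (s :* u) :* (:- σ) := :- (s :* (u :* σ))) refl sL u Σp ⟩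
      cutFormula p j                             ∎
      where
      sL = sgn last
      Σp = sumF (λ c → sgn (punchIn last c) * (p c * μ j c))
      T : Fin (suc (suc r)) → Carrier
      T l = sgn l * (x (τ j l) * det (λ a b → M a (τ j (punchIn l b))))
      lastTerm : T last ≈ sL * (x j * u)
      lastTerm = *-congˡ (*-cong (reflexive (≡.cong x (insertAt-lookup ι last j)))
                                 (det-cong _ B (λ a b → reflexive (≡.cong (M a) (insertAt-punchIn ι last j b)))))
      otherTerm : ∀ c → T (punchIn last c) ≈ sgn (punchIn last c) * (p c * μ j c)
      otherTerm c = *-congˡ (*-congʳ (trans (reflexive (≡.cong x (insertAt-punchIn ι last j c))) (x∘ι≈p c)))
      bordered≈0 : sL * (x j * u) + Σp ≈ 0#
      bordered≈0 = begin
        sL * (x j * u) + Σp                                ≈⟨ +-cong lastTerm (sumF-cong otherTerm) ⟨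
        T last + sumF (λ c → T (punchIn last c))           ≈⟨ sumF-remove last T ⟨
        sumF T                                             ≈⟨ det-bordered-rowSpace M (τ j) x∈row ⟩
        0#                                                 ∎

    cutFormula-isInteger : ∀ (a : Fin (suc r) → ℤ) j → suc r ≤ Fin.toℕ j → IsInteger (cutFormula (λ c → fromℤ (a c)) j)
    cutFormula-isInteger a j r<j =
      isInteger-neg (isInteger-* (isInteger-sgn last) (isInteger-* (isInteger-inZeroPmOne u-inZeroPmOne)
        (isInteger-sumF λ c → isInteger-* (isInteger-sgn (punchIn last c))
                                          (isInteger-* (a c , refl) (isInteger-inZeroPmOne (minor-inZeroPmOne c))))))
      where
      ι<j : ∀ c → ι c Fin.< j
      ι<j c = ≡.subst (ℕ._< Fin.toℕ j) (≡.sym (Fin.toℕ-inject≤ c r<n)) (ℕ.<-≤-trans (Fin.toℕ<n c) r<j)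
      τ↑ : StrictlyIncreasing (τ j)
      τ↑ = insertAt-last-increasing ι j (inject≤-increasing r<n) ι<j
      minor-inZeroPmOne : ∀ c → InZeroPmOne (μ j c)
      minor-inZeroPmOne c = proj₂ unimodular _ (∘-increasing τ↑ (punchIn-increasing (punchIn last c)))

    module _ (a : Fin (suc r) → ℤ) where

      prefix : Fin (suc r) → Carrier
      prefix c = fromℤ (a c)

      y : Fin (suc r) → Carrier
      y i = u * (sgn i * det (prefix ∷ removeAt B i))

      x : Fin n → Carrier
      x j = sumF (λ i → y i * M i j)

      x∈row : InRowSpace M x
      x∈row = y , λ _ → refl

      x∘ι≈prefix : ∀ k → x (ι k) ≈ prefix k
      x∘ι≈prefix k = begin
        sumF (λ i → (u * (sgn i * det (prefix ∷ removeAt B i))) * B i k)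
          ≈⟨ sumF-cong (λ i → *-assoc u (sgn i * det (prefix ∷ removeAt B i)) (B i k)) ⟩
        sumF (λ i → u * ((sgn i * det (prefix ∷ removeAt B i)) * B i k))
          ≈⟨ *-distribˡ-sumF u (λ i → (sgn i * det (prefix ∷ removeAt B i)) * B i k) ⟨
        u * sumF (λ i → (sgn i * det (prefix ∷ removeAt B i)) * B i k) ≈⟨ *-congˡ (cramer B prefix k) ⟩
        u * (prefix k * u)
          ≈⟨ solve 2 (λ u p → u :* (p :* u) := p :* (u :* u)) refl u (prefix k) ⟩
        prefix k * (u * u)                                              ≈⟨ *-congˡ u² ⟩
        prefix k * 1#                                                   ≈⟨ *-identityʳ (prefix k) ⟩
        prefix k                                                        ∎

      x-isInteger : ∀ j → IsInteger (x j)
      x-isInteger j with Fin.toℕ j ℕ.<? suc r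
      ... | yes j<1+r = isInteger-resp-≈ (trans (reflexive (≡.cong x (≡.sym ι-k≡j))) (x∘ι≈prefix k)) (a k , refl)
        where
        k = Fin.fromℕ< j<1+r
        ι-k≡j : ι k ≡ j
        ι-k≡j = Fin.toℕ-injective (≡.trans (Fin.toℕ-inject≤ k r<n) (Fin.toℕ-fromℕ< j<1+r))
      ... | no  j≮1+r = isInteger-resp-≈ (rowSpace⇒cutFormula x∈row x∘ι≈prefix j) (cutFormula-isInteger a j (ℕ.≮⇒≥ j≮1+r))

      γ : Fin n → ℤ
      γ j = proj₁ (x-isInteger j)

      γ≈x : ∀ j → fromℤ (γ j) ≈ x j
      γ≈x j = sym (proj₂ (x-isInteger j))

      γ-cut : IntegerCut M γ
      γ-cut = y , γ≈x

      γ-prefix : ∀ k → γ (ι k) ≡ a k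
      γ-prefix k = charZero _ _ (trans (γ≈x (ι k)) (x∘ι≈prefix k))

      γ-unique : (γ′ : Fin n → ℤ) → IntegerCut M γ′ → (∀ k → γ′ (ι k) ≡ a k) → ∀ j → γ′ j ≡ γ j
      γ-unique γ′ γ′-cut γ′-prefix j = charZero _ _ (begin
        fromℤ (γ′ j)         ≈⟨ rowSpace⇒cutFormula γ′-cut (λ k → reflexive (≡.cong fromℤ (γ′-prefix k))) j ⟩
        cutFormula prefix j  ≈⟨ rowSpace⇒cutFormula x∈row x∘ι≈prefix j ⟨
        x j                  ≈⟨ γ≈x j ⟨
        fromℤ (γ j)          ∎)

lemma2p11 : {c ℓ : Level} (F : CommutativeRing c ℓ) →
    LinAlg.IsField F → LinAlg.CharZero F →
    (r n : ℕ) → 0 < r → (r≤n : r ≤ n) →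
    (M : Fin r → Fin n → CommutativeRing.Carrier F) →
    LinAlg.FullRankWeaklyUnimodular F M →
    LinAlg.FirstColumnsIndep F r≤n M →
    (a : Fin r → ℤ) →
    Σ (Fin n → ℤ) (λ γ →
      (LinAlg.IntegerCut F M γ × (∀ i → γ (inject≤ i r≤n) ≡ a i)) ×
      ((γ′ : Fin n → ℤ) → LinAlg.IntegerCut F M γ′ →
        (∀ i → γ′ (inject≤ i r≤n) ≡ a i) → ∀ j → γ′ j ≡ γ j))
lemma2p11 F fld charZero (suc r) n _ r≤n M unimodular indep a =
  γ a , (γ-cut a , γ-prefix a) , γ-unique a
  where open IntegerCuts F fld charZero r≤n M unimodular indep
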